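{- Let $p$ be a prime and $n\geq 1$ an integer. Let $H$ be a subgroup of $\mathrm{GL}_2(\mathbb{Z}_p)$ containing $1+p^n\mathrm{M}_2(\mathbb{Z}_p)$, and let $H'$ be a closed subgroup of $\mathrm{GL}_2(\mathbb{Z}_p)$ which is a subgroup of $H$ of index $2$. If $p\geq 3$, then $H'\supseteq 1+p^n\mathrm{M}_2(\mathbb{Z}_p)$; if $p=2$ and $n\geq 2$, then $H'\supseteq 1+p^{n+1}\mathrm{M}_2(\mathbb{Z}_p)$. -}

module Defs where

open import Data.Nat as ℕ using (ℕ; suc)
open import Data.Integer as ℤ using (ℤ; +_; _-_)
open import Data.Product using (Σ; ∃; ∃-syntax; _×_; _,_)
open import Data.Sum using (_⊎_)
open import Relation.Nullary using (¬_)
open import Relation.Binary.PropositionalEquality using (_≡_; refl; trans; cong; cong₂)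
open import Data.Integer.Solver using (module +-*-Solver)
open +-*-Solver

-- The p-adic integers ℤ_p, presented as the inverse limit lim ℤ/p^k:
-- a sequence of integers (x_k) with x_{k+1} ≡ x_k (mod p^k),
-- two such sequences being equal iff x_k ≡ y_k (mod p^k) for all k.

infix 4 _∣_
_∣_ : ℤ → ℤ → Set
d ∣ z = ∃[ q ] z ≡ q ℤ.* d

pow : ℕ → ℕ → ℤ
pow p k = + (p ℕ.^ k)

record ℤₚ (p : ℕ) : Set where
  constructor mkℤₚ
  field
    seq : ℕ → ℤ
    coh : ∀ k → pow p k ∣ (seq (suc k) - seq k)
open ℤₚ public

module _ {p : ℕ} where

  infix 4 _≈ₚ_
  _≈ₚ_ : ℤₚ p → ℤₚ p → Set
  x ≈ₚ y = ∀ k → pow p k ∣ (seq x k - seq y k)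

  ι : ℤ → ℤₚ p
  ι z = mkℤₚ (λ _ → z) (λ k → + 0 , solve 2 (λ z q → z :- z := con (+ 0) :* q) refl z (pow p k))

  infixl 6 _+ₚ_
  infixl 7 _*ₚ_
  _+ₚ_ : ℤₚ p → ℤₚ p → ℤₚ p
  x +ₚ y = mkℤₚ (λ k → seq x k ℤ.+ seq y k) λ k → +coh (seq x (suc k)) (seq y (suc k)) (seq x k) (seq y k) (pow p k) (coh x k) (coh y k)
    where
    +coh : ∀ a b c e q → q ∣ a - c → q ∣ b - e → q ∣ (a ℤ.+ b) - (c ℤ.+ e)
    +coh a b c e q (u , eu) (v , ev) = u ℤ.+ v , trans
      (solve 4 (λ a b c e → (a :+ b) :- (c :+ e) := (a :- c) :+ (b :- e)) refl a b c e)
      (trans (cong₂ ℤ._+_ eu ev) (solve 3 (λ u v q → u :* q :+ v :* q := (u :+ v) :* q) refl u v q))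

  _*ₚ_ : ℤₚ p → ℤₚ p → ℤₚ p
  x *ₚ y = mkℤₚ (λ k → seq x k ℤ.* seq y k) λ k → *coh (seq x (suc k)) (seq y (suc k)) (seq x k) (seq y k) (pow p k) (coh x k) (coh y k)
    where
    *coh : ∀ a b c e q → q ∣ a - c → q ∣ b - e → q ∣ (a ℤ.* b) - (c ℤ.* e)
    *coh a b c e q (u , eu) (v , ev) = a ℤ.* v ℤ.+ u ℤ.* e , trans
      (solve 4 (λ a b c e → (a :* b) :- (c :* e) := a :* (b :- e) :+ (a :- c) :* e) refl a b c e)
      (trans (cong₂ (λ s t → a ℤ.* t ℤ.+ s ℤ.* e) eu ev) (solve 5 (λ a e u v q → a :* (v :* q) :+ (u :* q) :* e := (a :* v :+ u :* e) :* q) refl a e u v q))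

record M₂ (p : ℕ) : Set where
  constructor mat
  field
    a b c d : ℤₚ p
open M₂ public

module _ {p : ℕ} where

  infix 4 _≈M_
  _≈M_ : M₂ p → M₂ p → Set
  A ≈M B = (a A ≈ₚ a B) × (b A ≈ₚ b B) × (c A ≈ₚ c B) × (d A ≈ₚ d B)

  1M : M₂ p
  1M = mat (ι (+ 1)) (ι (+ 0)) (ι (+ 0)) (ι (+ 1))

  infixl 6 _+M_
  infixl 7 _*M_
  _+M_ : M₂ p → M₂ p → M₂ p
  A +M B = mat (a A +ₚ a B) (b A +ₚ b B) (c A +ₚ c B) (d A +ₚ d B)

  _*M_ : M₂ p → M₂ p → M₂ p
  A *M B = mat (a A *ₚ a B +ₚ b A *ₚ c B) (a A *ₚ b B +ₚ b A *ₚ d B)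
               (c A *ₚ a B +ₚ d A *ₚ c B) (c A *ₚ b B +ₚ d A *ₚ d B)

  _·M_ : ℤₚ p → M₂ p → M₂ p
  s ·M A = mat (s *ₚ a A) (s *ₚ b A) (s *ₚ c A) (s *ₚ d A)

  IsGL₂ : M₂ p → Set
  IsGL₂ A = ∃[ B ] (A *M B ≈M 1M) × (B *M A ≈M 1M)

  InΓ : ℕ → M₂ p → Set
  InΓ m A = ∃[ B ] A ≈M 1M +M (ι (pow p m) ·M B)

  CongMod : ℕ → M₂ p → M₂ p → Set
  CongMod k A B = ∃[ C ] A ≈M B +M (ι (pow p k) ·M C)

  Pred : Set₁
  Pred = M₂ p → Set

  _⊆_ : Pred → Pred → Set
  S ⊆ T = ∀ A → S A → T A

  record IsSubgroupGL₂ (H : Pred) : Set where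
    field
      respects : ∀ A B → A ≈M B → H A → H B
      ⊆GL      : ∀ A → H A → IsGL₂ A
      one      : H 1M
      mul      : ∀ A B → H A → H B → H (A *M B)
      inv      : ∀ A → H A → ∃[ B ] H B × (A *M B ≈M 1M) × (B *M A ≈M 1M)

  -- H is closed in GL₂(ℤ_p) for the p-adic topology:
  -- every invertible p-adic limit of elements of H lies in H
  IsClosed : Pred → Set
  IsClosed H = ∀ A → IsGL₂ A → (∀ k → ∃[ B ] H B × CongMod k A B) → H A

  -- H' is a subgroup of H of index 2: H' ⊆ H, and H is the disjoint union
  -- of the two left cosets H' and g H' for some g ∈ H ∖ H'
  Index2 : Pred → Pred → Set
  Index2 H' H = (H' ⊆ H) × ∃[ g ] (H g × ¬ H' g ×
                  (∀ h → H h → H' h ⊎ ∃[ h' ] H' h' × (h ≈M g *M h')))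

module Submission where

-- If H' has index 2 in H and g ∈ H ∖ H', then g² ∈ H' and, for h₁ ∈ H', also h₁g = gh₂ with
-- h₂ ∈ H'; hence h² ∈ H' for every h ∈ H (either h ∈ H', or h = gh₁ and h² = g²h₂h₁).  So H'
-- contains the squares (1 + pⁿX)² of the elements of 1 + pⁿM₂(ℤₚ) ⊆ H and, being closed, all
-- their p-adic limits.  Every 1 + pᴺB is such a limit: (1 + pⁿX)² = 1 + pᴺ(αX + p r X²), and
-- as α is a unit mod p, Newton's iteration solves αX + p r X² ≡ B modulo every pᵏ.  For odd p
-- this works with N = n, α = 2 and p r = pⁿ; for p = 2 the factor 2 has to go into pᴺ = pⁿ⁺¹,
-- leaving α = 1 and p r = pⁿ⁻¹, so n ≥ 2.

open import Data.Integer as ℤ using (ℤ; +_; -_)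
open import Data.Integer.Properties using (*-assoc; *-identityˡ; *-identityʳ; i≡j⇒i-j≡0; pos-*)
open import Data.Integer.Tactic.RingSolver using (solve-∀)
open import Data.Nat as ℕ using (ℕ; zero; suc; _≥_; s≤s)
open import Data.Nat.Divisibility using (m∣m*n)
open import Data.Nat.Primality using (Prime; prime⇒irreducible)
open import Data.Nat.Properties using (+-suc; +-comm; <-irrefl)
open import Data.Product using (∃-syntax; _×_; _,_)
open import Data.Sum using (_⊎_; inj₁; inj₂)
open import Relation.Binary.Bundles using (Setoid)
open import Relation.Binary.PropositionalEquality using (_≡_; refl; sym; trans; cong; subst)
open import Relation.Nullary using (¬_; contradiction)
import Data.Nat.Tactic.RingSolver as ℕ-Solver
import Relation.Binary.Reasoning.Setoid as SetoidReasoning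

open import Defs

module _ {p : ℕ} where

  open import Data.Integer using (_+_; _-_; _*_)

  private variable
    A B C X Y : M₂ p
    k n N : ℕ
    H H' : Pred {p}

  private
    *-distrib-combination : ∀ u v q r d → u * (q * d) + v * (r * d) ≡ (u * q + v * r) * d
    *-distrib-combination = solve-∀

  ∣-multiple : ∀ d {e x} u → e ≡ u * x → d ∣ x → d ∣ e
  ∣-multiple d u refl (q , refl) = u * q , sym (*-assoc u q d)

  ∣-combination : ∀ d {e x y} u v → e ≡ u * x + v * y → d ∣ x → d ∣ y → d ∣ e
  ∣-combination d u v refl (q , refl) (r , refl) = u * q + v * r , *-distrib-combination u v q r d

  infix 4 _≃_ _≋_

  -- _≈ₚ_, _≈M_ and the matrix operations are definitions that Agda unfolds into entries, so it
  -- cannot infer the compared elements from them; the record wrappers restore inference.  For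
  -- the same reason, and because unfolding matrix products is very costly, the congruence
  -- lemmas take their matrices explicitly.
  record _≃_ (x y : ℤₚ p) : Set where
    constructor ⟨_⟩
    field ≃⇒≈ₚ : x ≈ₚ y

  ≡⇒≃ : {x y : ℤₚ p} → (∀ k → seq x k ≡ seq y k) → x ≃ y
  ≡⇒≃ x≡y = ⟨ (λ k → + 0 , i≡j⇒i-j≡0 (x≡y k)) ⟩

  ≃-refl : {x : ℤₚ p} → x ≃ x
  ≃-refl = ≡⇒≃ (λ _ → refl)

  private
    sym-difference : ∀ x y → y - x ≡ - + 1 * (x - y)
    sym-difference = solve-∀
    trans-difference : ∀ x y z → x - z ≡ + 1 * (x - y) + + 1 * (y - z)
    trans-difference = solve-∀
    +-difference : ∀ x x' y y' → (x + y) - (x' + y') ≡ + 1 * (x - x') + + 1 * (y - y')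
    +-difference = solve-∀
    *-difference : ∀ x x' y y' → x * y - x' * y' ≡ y * (x - x') + x' * (y - y')
    *-difference = solve-∀

  ≃-sym : {x y : ℤₚ p} → x ≃ y → y ≃ x
  ≃-sym {x} {y} ⟨ x≈y ⟩ =
    ⟨ (λ k → ∣-multiple (pow p k) (- + 1) (sym-difference (seq x k) (seq y k)) (x≈y k)) ⟩

  ≃-trans : {x y z : ℤₚ p} → x ≃ y → y ≃ z → x ≃ z
  ≃-trans {x} {y} {z} ⟨ x≈y ⟩ ⟨ y≈z ⟩ =
    ⟨ (λ k → ∣-combination (pow p k) (+ 1) (+ 1) (trans-difference (seq x k) (seq y k) (seq z k)) (x≈y k) (y≈z k)) ⟩

  +ₚ-cong : {x x' y y' : ℤₚ p} → x ≃ x' → y ≃ y' → x +ₚ y ≃ x' +ₚ y'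
  +ₚ-cong {x} {x'} {y} {y'} ⟨ x≈x' ⟩ ⟨ y≈y' ⟩ =
    ⟨ (λ k → ∣-combination (pow p k) (+ 1) (+ 1) (+-difference (seq x k) (seq x' k) (seq y k) (seq y' k)) (x≈x' k) (y≈y' k)) ⟩

  *ₚ-cong : {x x' y y' : ℤₚ p} → x ≃ x' → y ≃ y' → x *ₚ y ≃ x' *ₚ y'
  *ₚ-cong {x} {x'} {y} {y'} ⟨ x≈x' ⟩ ⟨ y≈y' ⟩ =
    ⟨ (λ k → ∣-combination (pow p k) (seq y k) (seq x' k) (*-difference (seq x k) (seq x' k) (seq y k) (seq y' k)) (x≈x' k) (y≈y' k)) ⟩

  record _≋_ (A B : M₂ p) : Set where
    constructor mk≋
    field
      a≃ : a A ≃ a B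
      b≃ : b A ≃ b B
      c≃ : c A ≃ c B
      d≃ : d A ≃ d B
  open _≋_

  ≈M⇒≋ : A ≈M B → A ≋ B
  ≈M⇒≋ (a≈ , b≈ , c≈ , d≈) = mk≋ ⟨ a≈ ⟩ ⟨ b≈ ⟩ ⟨ c≈ ⟩ ⟨ d≈ ⟩

  ≋⇒≈M : A ≋ B → A ≈M B
  ≋⇒≈M (mk≋ ⟨ a≈ ⟩ ⟨ b≈ ⟩ ⟨ c≈ ⟩ ⟨ d≈ ⟩) = a≈ , b≈ , c≈ , d≈

  entrywise : (∀ k → seq (a A) k ≡ seq (a B) k) → (∀ k → seq (b A) k ≡ seq (b B) k) →
              (∀ k → seq (c A) k ≡ seq (c B) k) → (∀ k → seq (d A) k ≡ seq (d B) k) → A ≋ B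
  entrywise a≡ b≡ c≡ d≡ = mk≋ (≡⇒≃ a≡) (≡⇒≃ b≡) (≡⇒≃ c≡) (≡⇒≃ d≡)

  ≋-refl : A ≋ A
  ≋-refl = mk≋ ≃-refl ≃-refl ≃-refl ≃-refl

  ≋-sym : A ≋ B → B ≋ A
  ≋-sym (mk≋ a≃ b≃ c≃ d≃) = mk≋ (≃-sym a≃) (≃-sym b≃) (≃-sym c≃) (≃-sym d≃)

  ≋-trans : A ≋ B → B ≋ C → A ≋ C
  ≋-trans A≋B B≋C = mk≋ (≃-trans (a≃ A≋B) (a≃ B≋C)) (≃-trans (b≃ A≋B) (b≃ B≋C))
                        (≃-trans (c≃ A≋B) (c≃ B≋C)) (≃-trans (d≃ A≋B) (d≃ B≋C))

  ≋-setoid : Setoid _ _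
  ≋-setoid = record
    { Carrier       = M₂ p
    ; _≈_           = _≋_
    ; isEquivalence = record { refl = ≋-refl ; sym = ≋-sym ; trans = ≋-trans }
    }

  open SetoidReasoning ≋-setoid

  ≈M-refl : ∀ A → A ≈M A
  ≈M-refl A = ≋⇒≈M (≋-refl {A})

  +M-cong : ∀ A A' B B' → A ≋ A' → B ≋ B' → A +M B ≋ A' +M B'
  +M-cong _ _ _ _ A≋ B≋ = mk≋ (+ₚ-cong (a≃ A≋) (a≃ B≋)) (+ₚ-cong (b≃ A≋) (b≃ B≋))
                              (+ₚ-cong (c≃ A≋) (c≃ B≋)) (+ₚ-cong (d≃ A≋) (d≃ B≋))

  ·M-congˡ : ∀ s A A' → A ≋ A' → ι s ·M A ≋ ι s ·M A'
  ·M-congˡ s _ _ A≋ = mk≋ (*ₚ-cong (≃-refl {ι s}) (a≃ A≋)) (*ₚ-cong (≃-refl {ι s}) (b≃ A≋))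
                          (*ₚ-cong (≃-refl {ι s}) (c≃ A≋)) (*ₚ-cong (≃-refl {ι s}) (d≃ A≋))

  *M-cong : ∀ A A' B B' → A ≋ A' → B ≋ B' → A *M B ≋ A' *M B'
  *M-cong _ _ _ _ A≋ B≋ = mk≋
    (+ₚ-cong (*ₚ-cong (a≃ A≋) (a≃ B≋)) (*ₚ-cong (b≃ A≋) (c≃ B≋)))
    (+ₚ-cong (*ₚ-cong (a≃ A≋) (b≃ B≋)) (*ₚ-cong (b≃ A≋) (d≃ B≋)))
    (+ₚ-cong (*ₚ-cong (c≃ A≋) (a≃ B≋)) (*ₚ-cong (d≃ A≋) (c≃ B≋)))
    (+ₚ-cong (*ₚ-cong (c≃ A≋) (b≃ B≋)) (*ₚ-cong (d≃ A≋) (d≃ B≋)))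

  private
    dot-assoc : ∀ x₁ x₂ y₁₁ y₁₂ y₂₁ y₂₂ z₁ z₂ →
                (x₁ * y₁₁ + x₂ * y₂₁) * z₁ + (x₁ * y₁₂ + x₂ * y₂₂) * z₂ ≡
                x₁ * (y₁₁ * z₁ + y₁₂ * z₂) + x₂ * (y₂₁ * z₁ + y₂₂ * z₂)
    dot-assoc = solve-∀
    dot-identity₁ : ∀ x y → + 1 * x + + 0 * y ≡ x
    dot-identity₁ = solve-∀
    dot-identity₂ : ∀ x y → + 0 * x + + 1 * y ≡ y
    dot-identity₂ = solve-∀

  *M-assoc : ∀ A B C → (A *M B) *M C ≋ A *M (B *M C)
  *M-assoc A B C = entrywise
    (λ k → dot-assoc (seq (a A) k) (seq (b A) k) (seq (a B) k) (seq (b B) k) (seq (c B) k) (seq (d B) k)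
                     (seq (a C) k) (seq (c C) k))
    (λ k → dot-assoc (seq (a A) k) (seq (b A) k) (seq (a B) k) (seq (b B) k) (seq (c B) k) (seq (d B) k)
                     (seq (b C) k) (seq (d C) k))
    (λ k → dot-assoc (seq (c A) k) (seq (d A) k) (seq (a B) k) (seq (b B) k) (seq (c B) k) (seq (d B) k)
                     (seq (a C) k) (seq (c C) k))
    (λ k → dot-assoc (seq (c A) k) (seq (d A) k) (seq (a B) k) (seq (b B) k) (seq (c B) k) (seq (d B) k)
                     (seq (b C) k) (seq (d C) k))

  *M-identityˡ : ∀ A → 1M *M A ≋ A
  *M-identityˡ A = entrywise
    (λ k → dot-identity₁ (seq (a A) k) (seq (c A) k)) (λ k → dot-identity₁ (seq (b A) k) (seq (d A) k))
    (λ k → dot-identity₂ (seq (a A) k) (seq (c A) k)) (λ k → dot-identity₂ (seq (b A) k) (seq (d A) k))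

  *M-leftInverse-cancel : ∀ A' A → A' *M A ≋ 1M → ∀ X → A' *M (A *M X) ≋ X
  *M-leftInverse-cancel A' A A'A≋1 X = begin
    A' *M (A *M X)  ≈⟨ ≋-sym (*M-assoc A' A X) ⟩
    (A' *M A) *M X  ≈⟨ *M-cong (A' *M A) 1M X X A'A≋1 ≋-refl ⟩
    1M *M X         ≈⟨ *M-identityˡ X ⟩
    X               ∎

  *M-square-twisted : ∀ h g h₁ h₂ → h ≋ g *M h₁ → h₁ *M g ≋ g *M h₂ → h *M h ≋ (g *M g) *M (h₂ *M h₁)
  *M-square-twisted h g h₁ h₂ h≋gh₁ h₁g≋gh₂ = begin
    h *M h                  ≈⟨ *M-cong h (g *M h₁) h (g *M h₁) h≋gh₁ h≋gh₁ ⟩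
    (g *M h₁) *M (g *M h₁)  ≈⟨ *M-assoc g h₁ (g *M h₁) ⟩
    g *M (h₁ *M (g *M h₁))  ≈⟨ *M-cong g g (h₁ *M (g *M h₁)) ((h₁ *M g) *M h₁) ≋-refl
                                       (≋-sym (*M-assoc h₁ g h₁)) ⟩
    g *M ((h₁ *M g) *M h₁)  ≈⟨ *M-cong g g ((h₁ *M g) *M h₁) ((g *M h₂) *M h₁) ≋-refl
                                       (*M-cong (h₁ *M g) (g *M h₂) h₁ h₁ h₁g≋gh₂ ≋-refl) ⟩
    g *M ((g *M h₂) *M h₁)  ≈⟨ *M-cong g g ((g *M h₂) *M h₁) (g *M (h₂ *M h₁)) ≋-refl (*M-assoc g h₂ h₁) ⟩
    g *M (g *M (h₂ *M h₁))  ≈⟨ ≋-sym (*M-assoc g g (h₂ *M h₁)) ⟩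
    (g *M g) *M (h₂ *M h₁)  ∎

  module _ (H-subgroup : IsSubgroupGL₂ H) where
    open IsSubgroupGL₂ H-subgroup

    ∈-resp-≋ : A ≋ B → H A → H B
    ∈-resp-≋ {A} {B} A≋B = respects A B (≋⇒≈M A≋B)

    *M-cancelˡ : ∀ {A} → H A → A *M X ≋ A *M Y → X ≋ Y
    *M-cancelˡ {X} {Y} {A} A∈H AX≋AY =
      let A' , _ , _ , A'A≈1 = inv A A∈H
      in begin
        X               ≈⟨ ≋-sym (*M-leftInverse-cancel A' A (≈M⇒≋ A'A≈1) X) ⟩
        A' *M (A *M X)  ≈⟨ *M-cong A' A' (A *M X) (A *M Y) ≋-refl AX≋AY ⟩
        A' *M (A *M Y)  ≈⟨ *M-leftInverse-cancel A' A (≈M⇒≋ A'A≈1) Y ⟩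
        Y               ∎

    ∈-cancelˡ : ∀ {A} → H A → H (A *M X) → H X
    ∈-cancelˡ {X} {A} A∈H AX∈H =
      let A' , A'∈H , _ , A'A≈1 = inv A A∈H
      in ∈-resp-≋ (*M-leftInverse-cancel A' A (≈M⇒≋ A'A≈1) X) (mul A' (A *M X) A'∈H AX∈H)

  module Index2Squares (H-subgroup : IsSubgroupGL₂ H) (H'-subgroup : IsSubgroupGL₂ H') (H'⊆H : H' ⊆ H)
                       (g : M₂ p) (g∈H : H g) (g∉H' : ¬ H' g)
                       (coset : ∀ h → H h → H' h ⊎ ∃[ h' ] H' h' × (h ≈M g *M h')) where
    open IsSubgroupGL₂ H-subgroup using () renaming (mul to mulᴴ)
    open IsSubgroupGL₂ H'-subgroup using () renaming (mul to mulᴴ')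

    InH'∪gH' : M₂ p → Set
    InH'∪gH' h = H' h ⊎ ∃[ h' ] H' h' × (h ≈M g *M h')

    g²∈H' : H' (g *M g)
    g²∈H' = from-coset (coset (g *M g) (mulᴴ g g g∈H g∈H))
      where
      from-coset : InH'∪gH' (g *M g) → H' (g *M g)
      from-coset (inj₁ g²∈H') = g²∈H'
      from-coset (inj₂ (h₃ , h₃∈H' , g²≈gh₃)) =
        contradiction (∈-resp-≋ H'-subgroup (≋-sym (*M-cancelˡ H-subgroup g∈H (≈M⇒≋ g²≈gh₃))) h₃∈H') g∉H'

    g-normalises-H' : ∀ {h₁} → H' h₁ → ∃[ h₂ ] H' h₂ × (h₁ *M g ≋ g *M h₂)
    g-normalises-H' {h₁} h₁∈H' = from-coset (coset (h₁ *M g) (mulᴴ h₁ g (H'⊆H h₁ h₁∈H') g∈H))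
      where
      from-coset : InH'∪gH' (h₁ *M g) → ∃[ h₂ ] H' h₂ × (h₁ *M g ≋ g *M h₂)
      from-coset (inj₁ h₁g∈H') = contradiction (∈-cancelˡ H'-subgroup h₁∈H' h₁g∈H') g∉H'
      from-coset (inj₂ (h₂ , h₂∈H' , h₁g≈gh₂)) = h₂ , h₂∈H' , ≈M⇒≋ h₁g≈gh₂

    square∈H' : ∀ h → H h → H' (h *M h)
    square∈H' h h∈H = from-coset (coset h h∈H)
      where
      from-coset : InH'∪gH' h → H' (h *M h)
      from-coset (inj₁ h∈H') = mulᴴ' h h h∈H' h∈H'
      from-coset (inj₂ (h₁ , h₁∈H' , h≈gh₁)) =
        let h₂ , h₂∈H' , h₁g≋gh₂ = g-normalises-H' h₁∈H'
        in ∈-resp-≋ H'-subgroup (≋-sym (*M-square-twisted h g h₁ h₂ (≈M⇒≋ h≈gh₁) h₁g≋gh₂))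
                    (mulᴴ' (g *M g) (h₂ *M h₁) g²∈H' (mulᴴ' h₂ h₁ h₂∈H' h₁∈H'))

  private
    affine-regroup : ∀ δ s P x e → δ + s * (x + P * e) ≡ δ + s * x + P * (s * e)
    affine-regroup = solve-∀

  CongMod-resp : ∀ k A A' B B' → A ≋ A' → B ≋ B' → CongMod k A' B' → CongMod k A B
  CongMod-resp k A A' B B' A≋A' B≋B' (E , A'≈) = E , ≋⇒≈M (begin
    A                       ≈⟨ A≋A' ⟩
    A'                      ≈⟨ ≈M⇒≋ A'≈ ⟩
    B' +M ι (pow p k) ·M E  ≈⟨ +M-cong B' B (ι (pow p k) ·M E) (ι (pow p k) ·M E) (≋-sym B≋B') ≋-refl ⟩
    B +M ι (pow p k) ·M E   ∎)

  CongMod-affine : ∀ k C s B X → CongMod k B X → CongMod k (C +M ι s ·M B) (C +M ι s ·M X)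
  CongMod-affine k C s B X (E , B≈) = ι s ·M E , ≋⇒≈M (begin
    C +M ι s ·M B                         ≈⟨ +M-cong C C (ι s ·M B) (ι s ·M (X +M ι P ·M E)) ≋-refl
                                                     (·M-congˡ s B (X +M ι P ·M E) (≈M⇒≋ B≈)) ⟩
    C +M ι s ·M (X +M ι P ·M E)           ≈⟨ regroup ⟩
    (C +M ι s ·M X) +M ι P ·M (ι s ·M E)  ∎)
    where
    P : ℤ
    P = pow p k
    regroup : C +M ι s ·M (X +M ι P ·M E) ≋ (C +M ι s ·M X) +M ι P ·M (ι s ·M E)
    regroup = entrywise
      (λ j → affine-regroup (seq (a C) j) s P (seq (a X) j) (seq (a E) j))
      (λ j → affine-regroup (seq (b C) j) s P (seq (b X) j) (seq (b E) j))
      (λ j → affine-regroup (seq (c C) j) s P (seq (c X) j) (seq (c E) j))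
      (λ j → affine-regroup (seq (d C) j) s P (seq (d X) j) (seq (d E) j))

  0M : M₂ p
  0M = mat (ι (+ 0)) (ι (+ 0)) (ι (+ 0)) (ι (+ 0))

  quadratic : ℤ → ℤ → M₂ p → M₂ p
  quadratic α β X = ι α ·M X +M ι β ·M (X *M X)

  newtonError : (u w r P : ℤ) → M₂ p → M₂ p → M₂ p
  newtonError u w r P X E =
    ι (- w) ·M E +M ι (- (r * u)) ·M (X *M E +M E *M X) +M ι (- (r * P * u * u)) ·M (E *M E)

  private
    1+y-y≡1 : ∀ y → + 1 + y - y ≡ + 1
    1+y-y≡1 = solve-∀

    newton-expansion : ∀ α u w r P π x x₁ x₂ y₁ y₂ e e₁ e₂ f₁ f₂ →
      α * x + π * r * (x₁ * y₁ + x₂ * y₂) + P * e * (α * u - π * w) ≡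
      α * (x + P * u * e) + π * r * ((x₁ + P * u * e₁) * (y₁ + P * u * f₁) + (x₂ + P * u * e₂) * (y₂ + P * u * f₂))
        + π * P * (- w * e + - (r * u) * (x₁ * f₁ + x₂ * f₂ + (e₁ * y₁ + e₂ * y₂)) + - (r * P * u * u) * (e₁ * f₁ + e₂ * f₂))
    newton-expansion = solve-∀

    -- x is the entry (i,j) of X, (x₁, x₂) its row i and (y₁, y₂) its column j; likewise e, (e₁, e₂), (f₁, f₂) for E.
    newton-entry : ∀ α u w r P → α * u ≡ + 1 + + p * w → ∀ x x₁ x₂ y₁ y₂ e e₁ e₂ f₁ f₂ →
      α * x + + p * r * (x₁ * y₁ + x₂ * y₂) + P * e ≡
      α * (x + P * u * e) + + p * r * ((x₁ + P * u * e₁) * (y₁ + P * u * f₁) + (x₂ + P * u * e₂) * (y₂ + P * u * f₂))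
        + + p * P * (- w * e + - (r * u) * (x₁ * f₁ + x₂ * f₂ + (e₁ * y₁ + e₂ * y₂)) + - (r * P * u * u) * (e₁ * f₁ + e₂ * f₂))
    newton-entry α u w r P αu≡1+pw x x₁ x₂ y₁ y₂ e e₁ e₂ f₁ f₂ =
      trans (cong (λ z → α * x + + p * r * (x₁ * y₁ + x₂ * y₂) + z)
                  (trans (sym (*-identityʳ (P * e))) (cong (P * e *_) (sym αu-pw≡1))))
            (newton-expansion α u w r P (+ p) x x₁ x₂ y₁ y₂ e e₁ e₂ f₁ f₂)
      where
      αu-pw≡1 : α * u - + p * w ≡ + 1
      αu-pw≡1 = trans (cong (_- + p * w) αu≡1+pw) (1+y-y≡1 (+ p * w))

  -- One Newton step: as α u ≡ 1 (mod p), replacing X by X + P u E turns the error P E of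
  -- αX + p r X² = B into a multiple of p P.
  quadratic-newtonExpansion : ∀ α u w r P → α * u ≡ + 1 + + p * w → ∀ X E →
    quadratic α (+ p * r) X +M ι P ·M E ≋
    quadratic α (+ p * r) (X +M ι (P * u) ·M E) +M ι (+ p * P) ·M newtonError u w r P X E
  quadratic-newtonExpansion α u w r P αu≡1+pw X E = entrywise
    (λ k → newton-entry α u w r P αu≡1+pw
             (seq (a X) k) (seq (a X) k) (seq (b X) k) (seq (a X) k) (seq (c X) k)
             (seq (a E) k) (seq (a E) k) (seq (b E) k) (seq (a E) k) (seq (c E) k))
    (λ k → newton-entry α u w r P αu≡1+pw
             (seq (b X) k) (seq (a X) k) (seq (b X) k) (seq (b X) k) (seq (d X) k)
             (seq (b E) k) (seq (a E) k) (seq (b E) k) (seq (b E) k) (seq (d E) k))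
    (λ k → newton-entry α u w r P αu≡1+pw
             (seq (c X) k) (seq (c X) k) (seq (d X) k) (seq (a X) k) (seq (c X) k)
             (seq (c E) k) (seq (c E) k) (seq (d E) k) (seq (a E) k) (seq (c E) k))
    (λ k → newton-entry α u w r P αu≡1+pw
             (seq (d X) k) (seq (c X) k) (seq (d X) k) (seq (b X) k) (seq (d X) k)
             (seq (d E) k) (seq (c E) k) (seq (d E) k) (seq (b E) k) (seq (d E) k))

  quadratic-liftMod : ∀ α u w r → α * u ≡ + 1 + + p * w → ∀ k B X →
                      CongMod k B (quadratic α (+ p * r) X) → ∃[ X' ] CongMod (suc k) B (quadratic α (+ p * r) X')
  quadratic-liftMod α u w r αu≡1+pw k B X (E , B≈) = X' , E' , B≈'
    where
    X' : M₂ p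
    X' = X +M ι (pow p k * u) ·M E
    E' : M₂ p
    E' = newtonError u w r (pow p k) X E
    B≋ : B ≋ quadratic α (+ p * r) X +M ι (pow p k) ·M E
    B≋ = ≈M⇒≋ B≈
    B≈' : B ≈M quadratic α (+ p * r) X' +M ι (pow p (suc k)) ·M E'
    B≈' = subst (λ P → B ≈M quadratic α (+ p * r) X' +M ι P ·M E') (sym (pos-* p (p ℕ.^ k)))
                (≋⇒≈M (≋-trans B≋ (quadratic-newtonExpansion α u w r (pow p k) αu≡1+pw X E)))

  private
    zero-solution : ∀ α β x → x ≡ α * + 0 + β * (+ 0 * + 0 + + 0 * + 0) + + 1 * x
    zero-solution = solve-∀

  quadratic-solvableMod : ∀ α u w r → α * u ≡ + 1 + + p * w → ∀ B k → ∃[ X ] CongMod k B (quadratic α (+ p * r) X)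
  quadratic-solvableMod α u w r αu≡1+pw B zero = 0M , B , ≋⇒≈M B≋
    where
    B≋ : B ≋ quadratic α (+ p * r) 0M +M ι (pow p 0) ·M B
    B≋ = entrywise
      (λ k → zero-solution α (+ p * r) (seq (a B) k)) (λ k → zero-solution α (+ p * r) (seq (b B) k))
      (λ k → zero-solution α (+ p * r) (seq (c B) k)) (λ k → zero-solution α (+ p * r) (seq (d B) k))
  quadratic-solvableMod α u w r αu≡1+pw B (suc k) =
    let X , B≡X = quadratic-solvableMod α u w r αu≡1+pw B k
    in quadratic-liftMod α u w r αu≡1+pw k B X B≡X

  private
    square₁₁ : ∀ q x₁₁ x₁₂ x₂₁ → (+ 1 + q * x₁₁) * (+ 1 + q * x₁₁) + (+ 0 + q * x₁₂) * (+ 0 + q * x₂₁) ≡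
                                 + 1 + q * (+ 2 * x₁₁ + q * (x₁₁ * x₁₁ + x₁₂ * x₂₁))
    square₁₁ = solve-∀
    square₁₂ : ∀ q x₁₁ x₁₂ x₂₂ → (+ 1 + q * x₁₁) * (+ 0 + q * x₁₂) + (+ 0 + q * x₁₂) * (+ 1 + q * x₂₂) ≡
                                 + 0 + q * (+ 2 * x₁₂ + q * (x₁₁ * x₁₂ + x₁₂ * x₂₂))
    square₁₂ = solve-∀
    square₂₁ : ∀ q x₁₁ x₂₁ x₂₂ → (+ 0 + q * x₂₁) * (+ 1 + q * x₁₁) + (+ 1 + q * x₂₂) * (+ 0 + q * x₂₁) ≡
                                 + 0 + q * (+ 2 * x₂₁ + q * (x₂₁ * x₁₁ + x₂₂ * x₂₁))
    square₂₁ = solve-∀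
    square₂₂ : ∀ q x₁₂ x₂₁ x₂₂ → (+ 0 + q * x₂₁) * (+ 0 + q * x₁₂) + (+ 1 + q * x₂₂) * (+ 1 + q * x₂₂) ≡
                                 + 1 + q * (+ 2 * x₂₂ + q * (x₂₁ * x₁₂ + x₂₂ * x₂₂))
    square₂₂ = solve-∀

  square-1+qX : ∀ q X → (1M +M ι q ·M X) *M (1M +M ι q ·M X) ≋ 1M +M ι q ·M quadratic (+ 2) q X
  square-1+qX q X = entrywise
    (λ k → square₁₁ q (seq (a X) k) (seq (b X) k) (seq (c X) k))
    (λ k → square₁₂ q (seq (a X) k) (seq (b X) k) (seq (d X) k))
    (λ k → square₂₁ q (seq (a X) k) (seq (c X) k) (seq (d X) k))
    (λ k → square₂₂ q (seq (b X) k) (seq (c X) k) (seq (d X) k))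

  private
    scalar-pull-out : ∀ δ t q x → δ + t * q * x ≡ δ + q * (t * x)
    scalar-pull-out = solve-∀
    quadratic-pull-out : ∀ δ t q α β x s → δ + q * (t * α * x + t * β * s) ≡ δ + t * q * (α * x + β * s)
    quadratic-pull-out = solve-∀

    1+Q·x≡1+q·tx : ∀ δ t q Q x → Q ≡ t * q → δ + Q * x ≡ δ + q * (t * x)
    1+Q·x≡1+q·tx δ t q _ x refl = scalar-pull-out δ t q x

    1+q·quadratic≡ : ∀ δ t q Q α β α' β' → t * α ≡ α' → t * β ≡ β' → Q ≡ t * q →
                     ∀ x s → δ + q * (α' * x + β' * s) ≡ δ + Q * (α * x + β * s)
    1+q·quadratic≡ δ t q _ α β _ _ refl refl refl = quadratic-pull-out δ t q α β

  1+Q·X≋1+q·tX : ∀ t q Q X → Q ≡ t * q → 1M +M ι Q ·M X ≋ 1M +M ι q ·M (ι t ·M X)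
  1+Q·X≋1+q·tX t q Q X Q≡tq = entrywise
    (λ k → 1+Q·x≡1+q·tx (+ 1) t q Q (seq (a X) k) Q≡tq) (λ k → 1+Q·x≡1+q·tx (+ 0) t q Q (seq (b X) k) Q≡tq)
    (λ k → 1+Q·x≡1+q·tx (+ 0) t q Q (seq (c X) k) Q≡tq) (λ k → 1+Q·x≡1+q·tx (+ 1) t q Q (seq (d X) k) Q≡tq)

  1+q·quadratic-rescale : ∀ t q Q α β α' β' X → t * α ≡ α' → t * β ≡ β' → Q ≡ t * q →
                          1M +M ι q ·M quadratic α' β' X ≋ 1M +M ι Q ·M quadratic α β X
  1+q·quadratic-rescale t q Q α β α' β' X tα≡α' tβ≡β' Q≡tq = entrywise
    (λ k → rescale (+ 1) (seq (a X) k) (seq (a X) k * seq (a X) k + seq (b X) k * seq (c X) k))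
    (λ k → rescale (+ 0) (seq (b X) k) (seq (a X) k * seq (b X) k + seq (b X) k * seq (d X) k))
    (λ k → rescale (+ 0) (seq (c X) k) (seq (c X) k * seq (a X) k + seq (d X) k * seq (c X) k))
    (λ k → rescale (+ 1) (seq (d X) k) (seq (c X) k * seq (b X) k + seq (d X) k * seq (d X) k))
    where
    rescale : ∀ δ x s → δ + q * (α' * x + β' * s) ≡ δ + Q * (α * x + β * s)
    rescale δ = 1+q·quadratic≡ δ t q Q α β α' β' tα≡α' tβ≡β' Q≡tq

  -- The relations give (1 + pⁿX)² = 1 + pᴺ(αX + p r X²) with α a unit mod p.
  record SquareRootData (n N : ℕ) : Set where
    field
      α u w r t  : ℤ
      α-unit     : α * u ≡ + 1 + + p * w
      t*α≡2      : t * α ≡ + 2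
      t*pr≡pⁿ    : t * (+ p * r) ≡ pow p n
      pᴺ≡t*pⁿ    : pow p N ≡ t * pow p n

  module _ (D : SquareRootData n N) where
    open SquareRootData D

    InΓ-antitone : InΓ N ⊆ InΓ n
    InΓ-antitone A (B , A≈) = ι t ·M B , ≋⇒≈M A≋
      where
      A≋ : A ≋ 1M +M ι (pow p n) ·M (ι t ·M B)
      A≋ = ≋-trans (≈M⇒≋ A≈) (1+Q·X≋1+q·tX t (pow p n) (pow p N) B pᴺ≡t*pⁿ)

    square-1+pⁿX : ∀ X → (1M +M ι (pow p n) ·M X) *M (1M +M ι (pow p n) ·M X) ≋
                         1M +M ι (pow p N) ·M quadratic α (+ p * r) X
    square-1+pⁿX X = ≋-trans (square-1+qX (pow p n) X)
      (1+q·quadratic-rescale t (pow p n) (pow p N) α (+ p * r) (+ 2) (pow p n) X t*α≡2 t*pr≡pⁿ pᴺ≡t*pⁿ)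

    InΓ-approxBySquares : ∀ A → InΓ N A → ∀ k → ∃[ Y ] InΓ n Y × CongMod k A (Y *M Y)
    InΓ-approxBySquares A (B , A≈) k =
      let X , B≡X = quadratic-solvableMod α u w r α-unit B k
          Y = 1M +M ι (pow p n) ·M X
      in Y , (X , ≈M-refl Y) ,
         CongMod-resp k A (1M +M ι (pow p N) ·M B) (Y *M Y) (1M +M ι (pow p N) ·M quadratic α (+ p * r) X)
                      (≈M⇒≋ A≈) (square-1+pⁿX X) (CongMod-affine k 1M (pow p N) B (quadratic α (+ p * r) X) B≡X)

    index2-closed-⊇Γ : IsSubgroupGL₂ H → InΓ n ⊆ H → IsSubgroupGL₂ H' → IsClosed H' → Index2 H' H → InΓ N ⊆ H'
    index2-closed-⊇Γ {H} {H'} H-subgroup Γⁿ⊆H H'-subgroup H'-closed (H'⊆H , g , g∈H , g∉H' , coset) A A∈Γᴺ =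
      H'-closed A A-invertible squares-approximate
      where
      open Index2Squares H-subgroup H'-subgroup H'⊆H g g∈H g∉H' coset using (square∈H')
      A-invertible : IsGL₂ A
      A-invertible = IsSubgroupGL₂.⊆GL H-subgroup A (Γⁿ⊆H A (InΓ-antitone A A∈Γᴺ))
      squares-approximate : ∀ k → ∃[ B ] H' B × CongMod k A B
      squares-approximate k =
        let Y , Y∈Γⁿ , A≡Y² = InΓ-approxBySquares A A∈Γᴺ k
        in Y *M Y , square∈H' Y (Γⁿ⊆H Y Y∈Γⁿ) , A≡Y²

open import Data.Nat using (_+_; _*_)

oddSquareRootData : ∀ h n → n ≥ 1 → SquareRootData {suc (2 * h)} n n
oddSquareRootData h (suc n) _ = record
  { α = + 2 ; u = + suc h ; w = + 1 ; r = pow p n ; t = + 1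
  ; α-unit  = cong +_ (2*[1+h]≡1+p h)
  ; t*α≡2   = refl
  ; t*pr≡pⁿ = trans (*-identityˡ _) (sym (pos-* p (p ℕ.^ n)))
  ; pᴺ≡t*pⁿ = sym (*-identityˡ _)
  }
  where
  p : ℕ
  p = suc (2 * h)
  2*[1+h]≡1+p : ∀ h → 2 * suc h ≡ 1 + suc (2 * h) * 1
  2*[1+h]≡1+p = ℕ-Solver.solve-∀

twoSquareRootData : ∀ n → n ≥ 2 → SquareRootData {2} n (n + 1)
twoSquareRootData (suc (suc m)) _ = record
  { α = + 1 ; u = + 1 ; w = + 0 ; r = pow 2 m ; t = + 2
  ; α-unit  = refl
  ; t*α≡2   = refl
  ; t*pr≡pⁿ = sym (trans (pos-* 2 (2 * 2 ℕ.^ m)) (cong (+ 2 ℤ.*_) (pos-* 2 (2 ℕ.^ m))))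
  ; pᴺ≡t*pⁿ = trans (cong (pow 2) (+-comm (suc (suc m)) 1)) (pos-* 2 (2 ℕ.^ suc (suc m)))
  }
twoSquareRootData (suc zero) (s≤s ())

even⊎odd : ∀ m → (∃[ h ] m ≡ 2 * h) ⊎ (∃[ h ] m ≡ suc (2 * h))
even⊎odd zero = inj₁ (0 , refl)
even⊎odd (suc m) with even⊎odd m
... | inj₁ (h , refl) = inj₂ (h , refl)
... | inj₂ (h , refl) = inj₁ (suc h , cong suc (sym (+-suc h (h + 0))))

odd-prime : ∀ {p} → Prime p → p ≥ 3 → ∃[ h ] p ≡ suc (2 * h)
odd-prime {p} p-prime p≥3 with even⊎odd p
... | inj₂ p-odd = p-odd
... | inj₁ (h , refl) with prime⇒irreducible p-prime (m∣m*n h)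
...   | inj₁ ()
...   | inj₂ 2≡2h = contradiction (subst (3 ℕ.≤_) (sym 2≡2h) p≥3) (<-irrefl refl)

lemma2p3 : (p : ℕ) → Prime p → (n : ℕ) → n ≥ 1 →
           (H H' : Pred {p}) →
           IsSubgroupGL₂ H → InΓ n ⊆ H →
           IsSubgroupGL₂ H' → IsClosed H' → Index2 H' H →
           (p ≥ 3 → InΓ n ⊆ H') × (p ≡ 2 → n ≥ 2 → InΓ (n + 1) ⊆ H')
lemma2p3 p p-prime n n≥1 H H' H-subgroup Γⁿ⊆H H'-subgroup H'-closed H'-index2 = odd-case , even-case
  where
  Γᴺ⊆H' : ∀ {N} → SquareRootData {p} n N → InΓ N ⊆ H'
  Γᴺ⊆H' D = index2-closed-⊇Γ D H-subgroup Γⁿ⊆H H'-subgroup H'-closed H'-index2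
  odd-case : p ≥ 3 → InΓ n ⊆ H'
  odd-case p≥3 with odd-prime p-prime p≥3
  ... | h , refl = Γᴺ⊆H' (oddSquareRootData h n n≥1)
  even-case : p ≡ 2 → n ≥ 2 → InΓ (n + 1) ⊆ H'
  even-case refl n≥2 = Γᴺ⊆H' (twoSquareRootData n n≥2)
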